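{- Let $G$ be a weighted multigraph on $\{1,\dots,n\}$ with $v$ connected components, and let $Q_{n-v}$ be the $n\times n$ matrix with entries $(Q_{n-v})_{ij}=\varepsilon(\mathcal F^{ij}_{n-v})$. Then $Q_{n-v}=\varepsilon(\mathcal F_{n-v})\,\bar J$.
   Context: $G$ has edges with strictly positive weights. A spanning rooted forest of $G$ is an acyclic subgraph with vertex set $\{1,\dots,n\}$ having one marked vertex (root) in each tree. The weight of a subgraph is the product of its edge weights (1 if no edges); the weight $\varepsilon(\mathcal S)$ of a set of subgraphs is the sum of their weights (0 if empty). $\mathcal F_k$ is the set of spanning rooted forests with exactly $k$ edges; $\mathcal F^{ij}_k\subseteq\mathcal F_k$ consists of those in which $j$ belongs to the tree rooted at $i$. $V_i$ denotes the vertex set of the connected component of $G$ containing $i$, and $\bar J=(\bar J_{ij})$ has $\bar J_{ij}=1/|V_i|$ if $j\in V_i$ and $\bar J_{ij}=0$ otherwise. -}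

module Defs where

open import Level using (Level)
open import Data.Bool using (Bool; true; false; _∧_; _∨_; not; if_then_else_)
open import Data.Nat using (ℕ; zero; suc; _∸_; _≡ᵇ_)
open import Data.Fin using (Fin; zero; suc; _<_)
open import Data.Fin.Properties using (_≟_)
open import Data.Product using (_×_; _,_; proj₁; proj₂)
open import Relation.Nullary.Decidable using (⌊_⌋)
open import Algebra.Bundles using (CommutativeRing)

-- A multigraph on the vertex set Fin n with m edges: edge e joins the two
-- endpoints  ends e  (parallel edges and loops allowed).
Ends : ℕ → ℕ → Set
Ends n m = Fin m → Fin n × Fin n

-- An edge subset (subgraph with full vertex set), as a characteristic function.
EdgeSet : ℕ → Set
EdgeSet m = Fin m → Bool

_==_ : ∀ {n} → Fin n → Fin n → Bool
a == b = ⌊ a ≟ b ⌋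

anyFin : ∀ {n} → (Fin n → Bool) → Bool
anyFin {zero}  f = false
anyFin {suc n} f = f zero ∨ anyFin (λ x → f (suc x))

allFin : ∀ {n} → (Fin n → Bool) → Bool
allFin {zero}  f = true
allFin {suc n} f = f zero ∧ allFin (λ x → f (suc x))

countFin : ∀ {n} → (Fin n → Bool) → ℕ
countFin {zero}  f = zero
countFin {suc n} f = (if f zero then suc else (λ k → k)) (countFin (λ x → f (suc x)))

adj : ∀ {n m} → Ends n m → EdgeSet m → Fin n → Fin n → Bool
adj ends S u w = anyFin λ e →
  S e ∧ ((proj₁ (ends e) == u ∧ proj₂ (ends e) == w)
         ∨ (proj₂ (ends e) == u ∧ proj₁ (ends e) == w))

step : ∀ {n m} → Ends n m → EdgeSet m → (Fin n → Bool) → (Fin n → Bool)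
step ends S X w = X w ∨ anyFin (λ u → X u ∧ adj ends S u w)

iter : ∀ {A : Set} → ℕ → (A → A) → A → A
iter zero    f x = x
iter (suc k) f x = f (iter k f x)

-- conn ends S a b : a and b lie in the same connected component of the
-- subgraph (Fin n, S) (a path of length ≤ n exists).
conn : ∀ {n m} → Ends n m → EdgeSet m → Fin n → Fin n → Bool
conn {n} ends S a = iter n (step ends S) (λ x → a == x)

remove : ∀ {m} → EdgeSet m → Fin m → EdgeSet m
remove S e f = S f ∧ not (e == f)

-- S is acyclic: no edge of S lies on a cycle, i.e. for every edge of S the
-- endpoints are disconnected after removing it (this excludes loops and
-- parallel edges, which are cycles in a multigraph).
acyclic : ∀ {n m} → Ends n m → EdgeSet m → Bool
acyclic ends S = allFin λ e →
  not (S e) ∨ not (conn ends (remove S e) (proj₁ (ends e)) (proj₂ (ends e)))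

full : ∀ {m} → EdgeSet m
full _ = true

compSize : ∀ {n m} → Ends n m → Fin n → ℕ
compSize ends i = countFin (conn ends full i)

-- number of connected components of G (count the least vertex of each)
numComp : ∀ {n m} → Ends n m → ℕ
numComp ends = countFin λ i → not (anyFin λ j → ⌊ j Data.Fin.<? i ⌋ ∧ conn ends full j i)

-- (S , Rt) is a spanning rooted forest with exactly k edges:
-- S acyclic, |S| = k, and every tree contains exactly one root in Rt.
isRootedForest : ∀ {n m} → Ends n m → ℕ → EdgeSet m → (Fin n → Bool) → Bool
isRootedForest ends k S Rt =
  acyclic ends S ∧ (countFin S ≡ᵇ k)
  ∧ allFin (λ j → countFin (λ r → Rt r ∧ conn ends S r j) ≡ᵇ 1)

isRootedForestIJ : ∀ {n m} → Ends n m → ℕ → Fin n → Fin n →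
                   EdgeSet m → (Fin n → Bool) → Bool
isRootedForestIJ ends k i j S Rt =
  isRootedForest ends k S Rt ∧ Rt i ∧ conn ends S i j

module WithRing {c ℓ : Level} (R : CommutativeRing c ℓ) where
  open CommutativeRing R using (Carrier; _+_; _*_; 0#; 1#)

  sumFin : ∀ {n} → (Fin n → Carrier) → Carrier
  sumFin {zero}  f = 0#
  sumFin {suc n} f = f zero + sumFin (λ x → f (suc x))

  prodFin : ∀ {n} → (Fin n → Carrier) → Carrier
  prodFin {zero}  f = 1#
  prodFin {suc n} f = f zero * prodFin (λ x → f (suc x))

  sumSubsets : ∀ n → ((Fin n → Bool) → Carrier) → Carrier
  sumSubsets zero    F = F (λ ())
  sumSubsets (suc n) F =
    sumSubsets n (λ X → F (λ { zero → false ; (suc x) → X x }))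
    + sumSubsets n (λ X → F (λ { zero → true ; (suc x) → X x }))

  natR : ℕ → Carrier
  natR zero    = 0#
  natR (suc k) = 1# + natR k

  weight : ∀ {m} → (Fin m → Carrier) → EdgeSet m → Carrier
  weight w S = prodFin λ e → if S e then w e else 1#

  epsF : ∀ {n m} → Ends n m → (Fin m → Carrier) → ℕ → Carrier
  epsF {n} {m} ends w k =
    sumSubsets m λ S → sumSubsets n λ Rt →
      if isRootedForest ends k S Rt then weight w S else 0#

  epsFij : ∀ {n m} → Ends n m → (Fin m → Carrier) → ℕ → Fin n → Fin n → Carrier
  epsFij {n} {m} ends w k i j =
    sumSubsets m λ S → sumSubsets n λ Rt →
      if isRootedForestIJ ends k i j S Rt then weight w S else 0#

  Jbar : ∀ {n m} → Ends n m → (Carrier → Carrier) → Fin n → Fin n → Carrier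
  Jbar ends inv i j = if conn ends full i j then inv (natR (compSize ends i)) else 0#

{-# OPTIONS --safe #-}
-- A forest with k edges has at least n − k components, because deleting an
-- edge of a forest disconnects its endpoints. Hence a forest S with n − v edges
-- has exactly the components of G: every tree of S is a whole component V_i.
-- For such S, the root choices (one root per tree) rooting x ∈ V_i correspond
-- bijectively to those rooting i, by moving the root of that tree from x to i.
-- Every root choice roots exactly one vertex of V_i, so the choices rooting i
-- make up a 1/|V_i| fraction of all of them. If j ∈ V_i, then j lies in the
-- tree rooted at i exactly when i is a root, whence
-- |V_i| ε(F^{ij}_{n−v}) = ε(F_{n−v}); if j ∉ V_i, F^{ij}_{n−v} is empty.
module Submission where

open import Defs
open import Level using (Level)
open import Algebra.Bundles using (CommutativeRing)
open import Data.Bool using (Bool; true; false; _∧_; _∨_; not; if_then_else_)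
open import Data.Bool.Properties as Bool using (∧-zeroʳ; ∧-identityʳ; ∧-comm; ∨-comm; ∨-zeroʳ; not-¬; ¬-not; not-injective; T-≡)
open import Function.Bundles using (Equivalence)
open import Data.Nat as ℕ using (ℕ; zero; suc; z≤n; s≤s; _≡ᵇ_; _∸_)
import Data.Nat.Properties as ℕ
open import Data.Fin as Fin using (Fin; zero; suc; toℕ)
import Data.Fin.Properties as Fin
open import Data.Product using (Σ; _×_; _,_; proj₁; proj₂)
open import Data.Sum using (_⊎_; inj₁; inj₂)
open import Function using (_∘′_)
open import Relation.Nullary using (Dec; yes; no; ¬_; contradiction)
open import Relation.Nullary.Decidable using (⌊_⌋; ⌊⌋-map′)
open import Relation.Binary.PropositionalEquality using (_≡_; _≢_; refl; sym; trans; cong; cong₂; subst)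
open import Relation.Binary.Structures using (IsEquivalence)
open import Relation.Binary.Definitions using (Tri; tri<; tri≈; tri>)

∧-elim : ∀ {a b} → a ∧ b ≡ true → a ≡ true × b ≡ true
∧-elim {true} {true} _ = refl , refl

∧-intro : ∀ {a b} → a ≡ true → b ≡ true → a ∧ b ≡ true
∧-intro refl refl = refl

not-∨-false : ∀ a {b} → not a ∨ b ≡ false → a ≡ true × b ≡ false
not-∨-false true {false} _ = refl , refl

bool-ext : ∀ {b c} → (b ≡ true → c ≡ true) → (c ≡ true → b ≡ true) → b ≡ c
bool-ext {true}  {true}  _ _ = refl
bool-ext {true}  {false} f _ = sym (f refl)
bool-ext {false} {true}  _ g = g refl
bool-ext {false} {false} _ _ = refl

⌊⌋⇒ : ∀ {p} {P : Set p} (P? : Dec P) → ⌊ P? ⌋ ≡ true → P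
⌊⌋⇒ (yes p) _ = p

⌊⌋-true : ∀ {p} {P : Set p} (P? : Dec P) → P → ⌊ P? ⌋ ≡ true
⌊⌋-true (yes _) _ = refl
⌊⌋-true (no ¬p) p = contradiction p ¬p

⌊⌋-false : ∀ {p} {P : Set p} (P? : Dec P) → ¬ P → ⌊ P? ⌋ ≡ false
⌊⌋-false (yes p) ¬p = contradiction p ¬p
⌊⌋-false (no _) _ = refl

≡ᵇ⇒≡ : ∀ {a b} → (a ≡ᵇ b) ≡ true → a ≡ b
≡ᵇ⇒≡ {a} {b} e = ℕ.≡ᵇ⇒≡ a b (Equivalence.from T-≡ e)

≡⇒≡ᵇ : ∀ {a b} → a ≡ b → (a ≡ᵇ b) ≡ true
≡⇒≡ᵇ {a} {b} e = Equivalence.to T-≡ (ℕ.≡⇒≡ᵇ a b e)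

==-refl : ∀ {n} (a : Fin n) → (a == a) ≡ true
==-refl a = ⌊⌋-true (a Fin.≟ a) refl

==⇒≡ : ∀ {n} {a b : Fin n} → (a == b) ≡ true → a ≡ b
==⇒≡ {a = a} {b} = ⌊⌋⇒ (a Fin.≟ b)

≢⇒==false : ∀ {n} {a b : Fin n} → a ≢ b → (a == b) ≡ false
≢⇒==false {a = a} {b} = ⌊⌋-false (a Fin.≟ b)

==-suc : ∀ {n} (a b : Fin n) → (suc a == suc b) ≡ (a == b)
==-suc a b = ⌊⌋-map′ (cong suc) Fin.suc-injective (a Fin.≟ b)

<?⇒< : ∀ {n} {a b : Fin n} → ⌊ a Fin.<? b ⌋ ≡ true → a Fin.< b
<?⇒< {a = a} {b} = ⌊⌋⇒ (a Fin.<? b)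

_⊆ᵇ_ : ∀ {k} → (Fin k → Bool) → (Fin k → Bool) → Set
S ⊆ᵇ T = ∀ {e} → S e ≡ true → T e ≡ true

anyFin-intro : ∀ {n} (f : Fin n → Bool) x → f x ≡ true → anyFin f ≡ true
anyFin-intro f zero    fx rewrite fx = refl
anyFin-intro f (suc x) fx rewrite anyFin-intro (λ y → f (suc y)) x fx = ∨-zeroʳ (f zero)

anyFin-witness : ∀ {n} (f : Fin n → Bool) → anyFin f ≡ true → Σ (Fin n) (λ x → f x ≡ true)
anyFin-witness {suc n} f any-f with f zero in f0
... | true  = zero , f0
... | false with anyFin-witness (λ y → f (suc y)) any-f
...   | x , fx = suc x , fx

anyFin-cong : ∀ {n} {f g : Fin n → Bool} → (∀ x → f x ≡ g x) → anyFin f ≡ anyFin g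
anyFin-cong {zero}  f≗g = refl
anyFin-cong {suc n} f≗g = cong₂ _∨_ (f≗g zero) (anyFin-cong (λ y → f≗g (suc y)))

allFin-intro : ∀ {n} (f : Fin n → Bool) → (∀ x → f x ≡ true) → allFin f ≡ true
allFin-intro {zero}  f all-f = refl
allFin-intro {suc n} f all-f = ∧-intro (all-f zero) (allFin-intro (λ y → f (suc y)) (λ y → all-f (suc y)))

allFin-elim : ∀ {n} (f : Fin n → Bool) → allFin f ≡ true → ∀ x → f x ≡ true
allFin-elim f all-f zero    = proj₁ (∧-elim all-f)
allFin-elim f all-f (suc x) = allFin-elim (λ y → f (suc y)) (proj₂ (∧-elim {f zero} all-f)) x

allFin-counterexample : ∀ {n} (f : Fin n → Bool) → allFin f ≡ false → Σ (Fin n) (λ x → f x ≡ false)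
allFin-counterexample {suc n} f all-f with f zero in f0
... | false = zero , f0
... | true with allFin-counterexample (λ y → f (suc y)) all-f
...   | x , fx = suc x , fx

countFin-cong : ∀ {n} {f g : Fin n → Bool} → (∀ x → f x ≡ g x) → countFin f ≡ countFin g
countFin-cong {zero}  f≗g = refl
countFin-cong {suc n} f≗g =
  cong₂ (λ b c → (if b then suc else (λ k → k)) c) (f≗g zero) (countFin-cong (λ y → f≗g (suc y)))

countFin≤n : ∀ {n} (f : Fin n → Bool) → countFin f ℕ.≤ n
countFin≤n {zero}  f = z≤n
countFin≤n {suc n} f with f zero
... | true  = s≤s (countFin≤n (λ y → f (suc y)))
... | false = ℕ.m≤n⇒m≤1+n (countFin≤n (λ y → f (suc y)))

countFin-mono : ∀ {n} {f g : Fin n → Bool} → f ⊆ᵇ g → countFin f ℕ.≤ countFin g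
countFin-mono {zero} f⊆g = z≤n
countFin-mono {suc n} {f} {g} f⊆g with f zero in f0 | g zero in g0
... | true  | true  = s≤s (countFin-mono (λ {y} → f⊆g {suc y}))
... | true  | false = contradiction (f⊆g {zero} f0) (not-¬ g0)
... | false | true  = ℕ.m≤n⇒m≤1+n (countFin-mono (λ {y} → f⊆g {suc y}))
... | false | false = countFin-mono (λ {y} → f⊆g {suc y})

countFin-mono-< : ∀ {n} {f g : Fin n → Bool} → f ⊆ᵇ g →
                  ∀ x → f x ≡ false → g x ≡ true → countFin f ℕ.< countFin g
countFin-mono-< {suc n} {f} {g} f⊆g zero fx gx rewrite fx | gx = s≤s (countFin-mono (λ {y} → f⊆g {suc y}))
countFin-mono-< {suc n} {f} {g} f⊆g (suc x) fx gx with f zero in f0 | g zero in g0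
... | true  | true  = s≤s (countFin-mono-< (λ {y} → f⊆g {suc y}) x fx gx)
... | true  | false = contradiction (f⊆g {zero} f0) (not-¬ g0)
... | false | true  = ℕ.m≤n⇒m≤1+n (countFin-mono-< (λ {y} → f⊆g {suc y}) x fx gx)
... | false | false = countFin-mono-< (λ {y} → f⊆g {suc y}) x fx gx

countFin-false : ∀ {n} → countFin {n} (λ _ → false) ≡ 0
countFin-false {zero}  = refl
countFin-false {suc n} = countFin-false {n}

countFin-pos : ∀ {n} (f : Fin n → Bool) x → f x ≡ true → 0 ℕ.< countFin f
countFin-pos {n} f x fx =
  subst (ℕ._< countFin f) (countFin-false {n}) (countFin-mono-< (λ ()) x refl fx)

countFin≡suc⇒witness : ∀ {n k} (f : Fin n → Bool) → countFin f ≡ suc k → Σ (Fin n) (λ x → f x ≡ true)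
countFin≡suc⇒witness {suc n} f count-f with f zero in f0
... | true  = zero , f0
... | false = let x , fx = countFin≡suc⇒witness (λ y → f (suc y)) count-f in suc x , fx

countFin≡0⇒false : ∀ {n} (f : Fin n → Bool) → countFin f ≡ 0 → ∀ x → f x ≡ false
countFin≡0⇒false {suc n} f count-f x with f zero in f0
countFin≡0⇒false {suc n} f ()      x       | true
countFin≡0⇒false {suc n} f count-f zero    | false = f0
countFin≡0⇒false {suc n} f count-f (suc x) | false = countFin≡0⇒false (λ y → f (suc y)) count-f x

countFin≡1⇒unique : ∀ {n} (f : Fin n → Bool) → countFin f ≡ 1 → ∀ {a b} → f a ≡ true → f b ≡ true → a ≡ b
countFin≡1⇒unique {suc n} f count-f {a} {b} fa fb with f zero in f0
countFin≡1⇒unique {suc n} f count-f {zero}  {zero}  fa fb | true = refl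
countFin≡1⇒unique {suc n} f count-f {zero}  {suc b} fa fb | true =
  contradiction fb (not-¬ (countFin≡0⇒false (λ y → f (suc y)) (ℕ.suc-injective count-f) b))
countFin≡1⇒unique {suc n} f count-f {suc a} {b}     fa fb | true =
  contradiction fa (not-¬ (countFin≡0⇒false (λ y → f (suc y)) (ℕ.suc-injective count-f) a))
countFin≡1⇒unique {suc n} f count-f {zero}  {b}     fa fb | false = contradiction fa (not-¬ f0)
countFin≡1⇒unique {suc n} f count-f {suc a} {zero}  fa fb | false = contradiction fb (not-¬ f0)
countFin≡1⇒unique {suc n} f count-f {suc a} {suc b} fa fb | false =
  cong suc (countFin≡1⇒unique (λ y → f (suc y)) count-f fa fb)

countFin-singleton : ∀ {n} (i : Fin n) → countFin (λ x → x == i) ≡ 1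
countFin-singleton {suc n} zero rewrite ==-refl (zero {n}) =
  cong suc (trans (countFin-cong {n} (λ x → ≢⇒==false {a = suc x} {zero} (λ ()))) (countFin-false {n}))
countFin-singleton {suc n} (suc i) rewrite ≢⇒==false {a = zero {n}} {suc i} (λ ()) =
  trans (countFin-cong (λ x → ==-suc x i)) (countFin-singleton i)

countFin-remove : ∀ {m} (S : EdgeSet m) e → S e ≡ true → countFin S ≡ suc (countFin (remove S e))
countFin-remove {suc m} S zero Se rewrite Se | ==-refl (zero {m}) =
  cong suc (countFin-cong λ y →
    sym (trans (cong (λ b → S (suc y) ∧ not b) (≢⇒==false {a = zero} {suc y} (λ ()))) (∧-identityʳ (S (suc y)))))
countFin-remove {suc m} S (suc e) Se
  rewrite ≢⇒==false {a = suc e} {zero {m}} (λ ()) | ∧-identityʳ (S zero)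
        | countFin-remove (λ y → S (suc y)) e Se
        | countFin-cong {f = λ y → S (suc y) ∧ not (suc e == suc y)} {g = remove (λ y → S (suc y)) e}
                        (λ y → cong (λ b → S (suc y) ∧ not b) (==-suc e y))
  with S zero
... | true  = refl
... | false = refl

-- Counting equivalence classes

BoolRel : ℕ → Set
BoolRel n = Fin n → Fin n → Bool

IsBoolEquivalence : ∀ {n} → BoolRel n → Set
IsBoolEquivalence E = IsEquivalence (λ x y → E x y ≡ true)

_⊆ᵣ_ : ∀ {n} → BoolRel n → BoolRel n → Set
E ⊆ᵣ E' = ∀ {x y} → E x y ≡ true → E' x y ≡ true

-- A class is counted through its least element, so numComp ends is
-- definitionally classCount (conn ends full).
isClassLeast : ∀ {n} → BoolRel n → Fin n → Bool
isClassLeast E i = not (anyFin λ j → ⌊ j Fin.<? i ⌋ ∧ E j i)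

classCount : ∀ {n} → BoolRel n → ℕ
classCount E = countFin (isClassLeast E)

isClassLeast-antitone : ∀ {n} {E E' : BoolRel n} → E ⊆ᵣ E' → isClassLeast E' ⊆ᵇ isClassLeast E
isClassLeast-antitone {E = E} {E'} E⊆E' {i} least' with isClassLeast E i in least
... | true  = refl
... | false =
  let j , j<i∧Eji = anyFin-witness _ (not-injective least)
      j<i , Eji = ∧-elim {⌊ j Fin.<? i ⌋} j<i∧Eji
  in contradiction (anyFin-intro (λ j → ⌊ j Fin.<? i ⌋ ∧ E' j i) j (∧-intro j<i (E⊆E' Eji))) (not-¬ (not-injective least'))

classLeast : ∀ {n} {E : BoolRel n} → IsBoolEquivalence E → ∀ a → Σ (Fin n) (λ r → E r a ≡ true × isClassLeast E r ≡ true)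
classLeast {n} {E} E-equiv a = descend (suc (toℕ a)) a ℕ.≤-refl
  where
  open IsEquivalence E-equiv using () renaming (refl to E-refl; trans to E-trans)

  descend : ∀ fuel a → toℕ a ℕ.< fuel → Σ (Fin n) (λ r → E r a ≡ true × isClassLeast E r ≡ true)
  descend (suc fuel) a a<fuel with isClassLeast E a in least
  ... | true  = a , E-refl , least
  ... | false =
    let j , j<a∧Eja = anyFin-witness _ (not-injective least)
        j<a , Eja = ∧-elim {⌊ j Fin.<? a ⌋} j<a∧Eja
        r , Erj , r-least = descend fuel j (ℕ.≤-trans (<?⇒< j<a) (ℕ.≤-pred a<fuel))
    in r , E-trans Erj Eja , r-least

classCount-< : ∀ {n} {E E' : BoolRel n} → IsBoolEquivalence E → IsBoolEquivalence E' → E ⊆ᵣ E' →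
               ∀ {a b} → E' a b ≡ true → E a b ≡ false → classCount E' ℕ.< classCount E
classCount-< {n} {E} {E'} E-equiv E'-equiv E⊆E' {a} {b} E'ab ¬Eab = separate (Fin.<-cmp ra rb)
  where
  module E  = IsEquivalence E-equiv
  module E' = IsEquivalence E'-equiv

  ra = proj₁ (classLeast E-equiv a)
  rb = proj₁ (classLeast E-equiv b)
  Eraa = proj₁ (proj₂ (classLeast E-equiv a))
  Erbb = proj₁ (proj₂ (classLeast E-equiv b))

  E'rarb : E' ra rb ≡ true
  E'rarb = E'.trans (E⊆E' Eraa) (E'.trans E'ab (E⊆E' (E.sym Erbb)))

  notLeast : ∀ {r s} → r Fin.< s → E' r s ≡ true → isClassLeast E' s ≡ false
  notLeast {r} {s} r<s E'rs =
    cong not (anyFin-intro (λ j → ⌊ j Fin.<? s ⌋ ∧ E' j s) r (∧-intro (⌊⌋-true (r Fin.<? s) r<s) E'rs))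

  splitAt : ∀ s → isClassLeast E s ≡ true → isClassLeast E' s ≡ false → classCount E' ℕ.< classCount E
  splitAt s least ¬least' = countFin-mono-< (isClassLeast-antitone {E = E} {E'} E⊆E') s ¬least' least

  separate : Tri (ra Fin.< rb) (ra ≡ rb) (rb Fin.< ra) → classCount E' ℕ.< classCount E
  separate (tri< ra<rb _ _) = splitAt rb (proj₂ (proj₂ (classLeast E-equiv b))) (notLeast ra<rb E'rarb)
  separate (tri> _ _ rb<ra) = splitAt ra (proj₂ (proj₂ (classLeast E-equiv a))) (notLeast rb<ra (E'.sym E'rarb))
  separate (tri≈ _ ra≡rb _) =
    contradiction (E.trans (E.sym Eraa) (subst (λ r → E r b ≡ true) (sym ra≡rb) Erbb)) (not-¬ ¬Eab)

module Connectivity {n m : ℕ} (ends : Ends n m) where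

  data Walk (S : EdgeSet m) (a : Fin n) : Fin n → Set where
    []  : Walk S a a
    _▷_ : ∀ {u w} → Walk S a u → adj ends S u w ≡ true → Walk S a w

  _++ʷ_ : ∀ {S a u w} → Walk S a u → Walk S u w → Walk S a w
  p ++ʷ []      = p
  p ++ʷ (q ▷ e) = (p ++ʷ q) ▷ e

  joins : Fin n → Fin n → Fin m → Bool
  joins u w e = (proj₁ (ends e) == u ∧ proj₂ (ends e) == w) ∨ (proj₂ (ends e) == u ∧ proj₁ (ends e) == w)

  adj-sym : ∀ S {u w} → adj ends S u w ≡ true → adj ends S w u ≡ true
  adj-sym S {u} {w} = subst (_≡ true) (anyFin-cong λ e → cong (S e ∧_) (swapped (ends e)))
    where
    swapped : ∀ ((x , y) : Fin n × Fin n) →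
              ((x == u ∧ y == w) ∨ (y == u ∧ x == w)) ≡ ((x == w ∧ y == u) ∨ (y == w ∧ x == u))
    swapped (x , y) = trans (∨-comm (x == u ∧ y == w) (y == u ∧ x == w))
                            (cong₂ _∨_ (∧-comm (y == u) (x == w)) (∧-comm (x == u) (y == w)))

  reverse : ∀ {S a b} → Walk S a b → Walk S b a
  reverse []          = []
  reverse {S} (p ▷ e) = ([] ▷ adj-sym S e) ++ʷ reverse p

  adj-mono : ∀ {S T} → S ⊆ᵇ T → ∀ {u w} → adj ends S u w ≡ true → adj ends T u w ≡ true
  adj-mono {S} {T} S⊆T {u} {w} adj-S =
    let e , Se∧joins = anyFin-witness (λ e → S e ∧ joins u w e) adj-S
        Se , joins-e = ∧-elim {S e} Se∧joins
    in anyFin-intro (λ e → T e ∧ joins u w e) e (∧-intro (S⊆T Se) joins-e)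

  walk-mono : ∀ {S T} → S ⊆ᵇ T → ∀ {a b} → Walk S a b → Walk T a b
  walk-mono S⊆T []      = []
  walk-mono S⊆T (p ▷ e) = walk-mono S⊆T p ▷ adj-mono S⊆T e

  edge-walk : ∀ S e → S e ≡ true → Walk S (proj₁ (ends e)) (proj₂ (ends e))
  edge-walk S e Se = [] ▷ anyFin-intro (λ f → S f ∧ joins x y f) e S∧joins
    where
    x = proj₁ (ends e)
    y = proj₂ (ends e)
    S∧joins : S e ∧ joins x y e ≡ true
    S∧joins rewrite Se | ==-refl x | ==-refl y = refl

  ball : EdgeSet m → Fin n → ℕ → Fin n → Bool
  ball S a k = iter k (step ends S) (λ x → a == x)

  ball⇒walk : ∀ S a k {b} → ball S a k b ≡ true → Walk S a b
  ball⇒walk S a zero    b∈ball = subst (Walk S a) (==⇒≡ b∈ball) []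
  ball⇒walk S a (suc k) {b} b∈ball with ball S a k b in b∈ball'
  ... | true  = ball⇒walk S a k b∈ball'
  ... | false =
    let u , u∈ball∧adj = anyFin-witness _ b∈ball
        u∈ball , adj-ub = ∧-elim {ball S a k u} u∈ball∧adj
    in ball⇒walk S a k u∈ball ▷ adj-ub

  step-inflationary : ∀ S (Y : Fin n → Bool) {w} → Y w ≡ true → step ends S Y w ≡ true
  step-inflationary S Y Yw rewrite Yw = refl

  step-extends : ∀ S (Y : Fin n → Bool) {u w} → Y u ≡ true → adj ends S u w ≡ true → step ends S Y w ≡ true
  step-extends S Y {u} {w} Yu adj-uw
    rewrite anyFin-intro (λ v → Y v ∧ adj ends S v w) u (∧-intro Yu adj-uw) = ∨-zeroʳ (Y w)

  Closed : EdgeSet m → (Fin n → Bool) → Set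
  Closed S Y = ∀ {w} → step ends S Y w ≡ true → Y w ≡ true

  step-closed : ∀ S Y → Closed S Y → Closed S (step ends S Y)
  step-closed S Y closed {w} = step-inflationary S Y ∘′ closed ∘′ subst (_≡ true) (step-cong w)
    where
    step-cong : ∀ w → step ends S (step ends S Y) w ≡ step ends S Y w
    step-cong w = cong₂ _∨_ (fixed w) (anyFin-cong λ u → cong (_∧ adj ends S u w) (fixed u))
      where
      fixed : ∀ x → step ends S Y x ≡ Y x
      fixed x = bool-ext closed (step-inflationary S Y)

  ball-center : ∀ S a k → ball S a k a ≡ true
  ball-center S a zero    = ==-refl a
  ball-center S a (suc k) = step-inflationary S (ball S a k) (ball-center S a k)

  -- While the ball grows it gains a vertex per step, and it has at most n
  -- vertices, so the n-th ball is closed.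
  ball-closed-or-large : ∀ S a k → Closed S (ball S a k) ⊎ suc k ℕ.≤ countFin (ball S a k)
  ball-closed-or-large S a zero = inj₂ (countFin-pos (λ x → a == x) a (==-refl a))
  ball-closed-or-large S a (suc k) with ball-closed-or-large S a k
  ... | inj₁ closed = inj₁ (step-closed S (ball S a k) closed)
  ... | inj₂ large with allFin (λ w → not (step ends S (ball S a k) w) ∨ ball S a k w) in closed?
  ...   | true  = inj₁ (step-closed S (ball S a k) (λ {w} → closed-at w (allFin-elim _ closed? w)))
    where
    closed-at : ∀ w → not (step ends S (ball S a k) w) ∨ ball S a k w ≡ true →
                step ends S (ball S a k) w ≡ true → ball S a k w ≡ true
    closed-at w step⇒ball step-w rewrite step-w = step⇒ball
  ...   | false =
    let w , escapes = allFin-counterexample _ closed?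
        step-w , ball-w = not-∨-false (step ends S (ball S a k) w) escapes
    in inj₂ (ℕ.≤-trans (s≤s large) (countFin-mono-< (step-inflationary S (ball S a k)) w ball-w step-w))

  ball-n-closed : ∀ S a → Closed S (ball S a n)
  ball-n-closed S a with ball-closed-or-large S a n
  ... | inj₁ closed = closed
  ... | inj₂ large  = contradiction (countFin≤n (ball S a n)) (ℕ.<⇒≱ large)

  walk⇒ball-n : ∀ {S a b} → Walk S a b → ball S a n b ≡ true
  walk⇒ball-n {S} {a} []              = ball-center S a n
  walk⇒ball-n {S} {a} (p ▷ e) = ball-n-closed S a (step-extends S (ball S a n) (walk⇒ball-n p) e)

  Conn : EdgeSet m → Fin n → Fin n → Set
  Conn S a b = conn ends S a b ≡ true

  conn⇒walk : ∀ {S a b} → Conn S a b → Walk S a b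
  conn⇒walk {S} {a} = ball⇒walk S a n

  conn-isEquivalence : ∀ S → IsBoolEquivalence (conn ends S)
  conn-isEquivalence S = record
    { refl  = λ {a} → walk⇒ball-n {S} {a} []
    ; sym   = λ ab → walk⇒ball-n (reverse (conn⇒walk ab))
    ; trans = λ ab bc → walk⇒ball-n (conn⇒walk ab ++ʷ conn⇒walk bc)
    }

  conn-mono : ∀ {S T} → S ⊆ᵇ T → conn ends S ⊆ᵣ conn ends T
  conn-mono S⊆T = walk⇒ball-n ∘′ walk-mono S⊆T ∘′ conn⇒walk

  conn-antitone : ∀ {S T} → S ⊆ᵇ T → ∀ {a b} → conn ends T a b ≡ false → conn ends S a b ≡ false
  conn-antitone S⊆T ¬Tab = ¬-not λ Sab → not-¬ (conn-mono S⊆T Sab) ¬Tab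

  conn-edge : ∀ S e → S e ≡ true → Conn S (proj₁ (ends e)) (proj₂ (ends e))
  conn-edge S e Se = walk⇒ball-n (edge-walk S e Se)

module Forests {n m : ℕ} (ends : Ends n m) where
  open Connectivity ends

  remove-⊆ : ∀ (S : EdgeSet m) e → remove S e ⊆ᵇ S
  remove-⊆ S e {f} f∈ = proj₁ (∧-elim {S f} f∈)

  acyclic⇒bridge : ∀ {S} → acyclic ends S ≡ true → ∀ {e} → S e ≡ true →
                   conn ends (remove S e) (proj₁ (ends e)) (proj₂ (ends e)) ≡ false
  acyclic⇒bridge {S} acyc {e} Se with allFin-elim _ acyc e
  ... | bridge rewrite Se = not-injective bridge

  acyclic-remove : ∀ {S} e → acyclic ends S ≡ true → acyclic ends (remove S e) ≡ true
  acyclic-remove {S} e acyc = allFin-intro _ λ f → ¬-not λ cycle →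
    let f∈S-e , ¬bridge = not-∨-false (remove S e f) cycle
    in not-¬ (not-injective ¬bridge)
         (conn-antitone (remove-remove f) (acyclic⇒bridge acyc (remove-⊆ S e {f} f∈S-e)))
    where
    remove-remove : ∀ f → remove (remove S e) f ⊆ᵇ remove S f
    remove-remove f {g} g∈ = let g∈S-e , g≢f = ∧-elim {remove S e g} g∈ in ∧-intro (remove-⊆ S e {g} g∈S-e) g≢f

  classCount+size≤n : ∀ k {S} → acyclic ends S ≡ true → countFin S ≡ k → classCount (conn ends S) ℕ.+ k ℕ.≤ n
  classCount+size≤n zero    {S} _    _    = ℕ.≤-trans (ℕ.≤-reflexive (ℕ.+-identityʳ _)) (countFin≤n _)
  classCount+size≤n (suc k) {S} acyc size =
    let e , Se = countFin≡suc⇒witness S size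
        S-e = remove S e
        splits : classCount (conn ends S) ℕ.< classCount (conn ends S-e)
        splits = classCount-< (conn-isEquivalence S-e) (conn-isEquivalence S) (conn-mono (remove-⊆ S e))
                              (conn-edge S e Se) (acyclic⇒bridge acyc Se)
        size' : countFin S-e ≡ k
        size' = ℕ.suc-injective (trans (sym (countFin-remove S e Se)) size)
    in begin
      classCount (conn ends S) ℕ.+ suc k   ≡⟨ ℕ.+-suc _ k ⟩
      suc (classCount (conn ends S)) ℕ.+ k ≤⟨ ℕ.+-monoˡ-≤ k splits ⟩
      classCount (conn ends S-e) ℕ.+ k     ≤⟨ classCount+size≤n k (acyclic-remove e acyc) size' ⟩
      n                                    ∎
    where open ℕ.≤-Reasoning

  forest-spanning : ∀ {S} → acyclic ends S ≡ true → countFin S ≡ n ∸ numComp ends →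
                    conn ends full ⊆ᵣ conn ends S
  forest-spanning {S} acyc size {a} {b} ab = ¬-not λ ¬Sab →
    let v = numComp ends
        more-components : v ℕ.< classCount (conn ends S)
        more-components = classCount-< (conn-isEquivalence S) (conn-isEquivalence full) (conn-mono (λ _ → refl)) ab ¬Sab
    in ℕ.<⇒≱ (ℕ.+-monoˡ-< (n ∸ v) more-components)
         (ℕ.≤-trans (classCount+size≤n (n ∸ v) acyc size) (ℕ.≤-reflexive (sym (ℕ.m+[n∸m]≡n (countFin≤n _)))))

_≐_ : ∀ {n} → (Fin n → Bool) → (Fin n → Bool) → Bool
Y ≐ Z = allFin λ r → ⌊ Y r Bool.≟ Z r ⌋

≐⇒≗ : ∀ {n} {Y Z : Fin n → Bool} → Y ≐ Z ≡ true → ∀ r → Y r ≡ Z r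
≐⇒≗ {Y = Y} {Z} Y≐Z r = ⌊⌋⇒ (Y r Bool.≟ Z r) (allFin-elim _ Y≐Z r)

≗⇒≐ : ∀ {n} {Y Z : Fin n → Bool} → (∀ r → Y r ≡ Z r) → Y ≐ Z ≡ true
≗⇒≐ {Y = Y} {Z} Y≗Z = allFin-intro _ λ r → ⌊⌋-true (Y r Bool.≟ Z r) (Y≗Z r)

module RootSelections {n : ℕ} {C : BoolRel n} (C-equiv : IsBoolEquivalence C) where
  open IsEquivalence C-equiv renaming (refl to C-refl; sym to C-sym; trans to C-trans)

  -- For C = conn ends S this is definitionally the root condition of isRootedForest.
  oneRootPerClass : (Fin n → Bool) → Bool
  oneRootPerClass Rt = allFin λ j → countFin (λ r → Rt r ∧ C r j) ≡ᵇ 1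

  rootsOf : (Fin n → Bool) → Fin n → Fin n → Bool
  rootsOf Rt j r = Rt r ∧ C r j

  oneRootPerClass-elim : ∀ {Rt} → oneRootPerClass Rt ≡ true → ∀ j → countFin (rootsOf Rt j) ≡ 1
  oneRootPerClass-elim valid j = ≡ᵇ⇒≡ (allFin-elim _ valid j)

  oneRootPerClass-intro : ∀ {Rt} → (∀ j → countFin (rootsOf Rt j) ≡ 1) → oneRootPerClass Rt ≡ true
  oneRootPerClass-intro one = allFin-intro _ λ j → ≡⇒≡ᵇ (one j)

  oneRootPerClass-resp-≗ : ∀ {Rt Rt'} → (∀ r → Rt r ≡ Rt' r) → oneRootPerClass Rt ≡ true → oneRootPerClass Rt' ≡ true
  oneRootPerClass-resp-≗ Rt≗Rt' valid = oneRootPerClass-intro λ j →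
    trans (countFin-cong λ r → cong (_∧ C r j) (sym (Rt≗Rt' r))) (oneRootPerClass-elim valid j)

  moveRoot : Fin n → (Fin n → Bool) → (Fin n → Bool)
  moveRoot z Rt r = if C r z then r == z else Rt r

  moveRoot-cong : ∀ z {Rt Rt'} → (∀ r → Rt r ≡ Rt' r) → ∀ r → moveRoot z Rt r ≡ moveRoot z Rt' r
  moveRoot-cong z Rt≗Rt' r = cong (if C r z then r == z else_) (Rt≗Rt' r)

  moveRoot-self : ∀ z Rt → moveRoot z Rt z ≡ true
  moveRoot-self z Rt rewrite C-refl {z} = ==-refl z

  oneRootPerClass-moveRoot : ∀ z {Rt} → oneRootPerClass Rt ≡ true → oneRootPerClass (moveRoot z Rt) ≡ true
  oneRootPerClass-moveRoot z {Rt} valid = oneRootPerClass-intro one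
    where
    one : ∀ j → countFin (rootsOf (moveRoot z Rt) j) ≡ 1
    one j with C j z in jz
    ... | true  = trans (countFin-cong only-z) (countFin-singleton z)
      where
      only-z : ∀ s → rootsOf (moveRoot z Rt) j s ≡ (s == z)
      only-z s with C s z in sz
      ... | true  = trans (cong ((s == z) ∧_) (C-trans sz (C-sym jz))) (∧-identityʳ _)
      ... | false = trans (cong (Rt s ∧_) (¬-not λ sj → not-¬ (C-trans sj jz) sz))
                    (trans (∧-zeroʳ (Rt s)) (sym (≢⇒==false λ { refl → not-¬ C-refl sz })))
    ... | false = trans (countFin-cong unmoved) (oneRootPerClass-elim valid j)
      where
      unmoved : ∀ s → rootsOf (moveRoot z Rt) j s ≡ rootsOf Rt j s
      unmoved s with C s j in sj
      ... | false = trans (∧-zeroʳ _) (sym (∧-zeroʳ _))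
      ... | true  = cong (_∧ true) (cong (if_then s == z else Rt s) (¬-not λ sz → not-¬ (C-trans (C-sym sj) sz) jz))

  moveRoot-inverse : ∀ {Rt x z} → oneRootPerClass Rt ≡ true → Rt x ≡ true → C x z ≡ true →
                  ∀ r → moveRoot x (moveRoot z Rt) r ≡ Rt r
  moveRoot-inverse {Rt} {x} {z} valid Rtx xz r with C r x in rx
  ... | true  = bool-ext (λ r==x → subst (λ y → Rt y ≡ true) (sym (==⇒≡ r==x)) Rtx)
                         (λ Rtr → subst (λ y → (r == y) ≡ true)
                                        (countFin≡1⇒unique _ (oneRootPerClass-elim valid x) (∧-intro Rtr rx) (∧-intro Rtx C-refl))
                                        (==-refl r))
  ... | false = cong (if_then r == z else Rt r) (¬-not λ rz → not-¬ (C-trans rz (C-sym xz)) rx)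

  moveRoot-graph : ∀ {x z} → C x z ≡ true → ∀ Rt Rt' →
                   (oneRootPerClass Rt ∧ Rt x) ∧ (Rt' ≐ moveRoot z Rt) ≡ (oneRootPerClass Rt' ∧ Rt' z) ∧ (Rt ≐ moveRoot x Rt')
  moveRoot-graph xz Rt Rt' = bool-ext (forth xz) (forth (C-sym xz))
    where
    forth : ∀ {x z Rt Rt'} → C x z ≡ true → (oneRootPerClass Rt ∧ Rt x) ∧ (Rt' ≐ moveRoot z Rt) ≡ true →
            (oneRootPerClass Rt' ∧ Rt' z) ∧ (Rt ≐ moveRoot x Rt') ≡ true
    forth {x} {z} {Rt} {Rt'} xz graph =
      let valid∧Rtx , Rt'≐ = ∧-elim {oneRootPerClass Rt ∧ Rt x} graph
          valid , Rtx = ∧-elim {oneRootPerClass Rt} valid∧Rtx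
          Rt'≗ = ≐⇒≗ Rt'≐
      in ∧-intro (∧-intro (oneRootPerClass-resp-≗ (λ r → sym (Rt'≗ r)) (oneRootPerClass-moveRoot z valid))
                          (trans (Rt'≗ z) (moveRoot-self z Rt)))
                 (≗⇒≐ λ r → sym (trans (moveRoot-cong x Rt'≗ r) (moveRoot-inverse valid Rtx xz r)))

module RingSums {c ℓ : Level} (R : CommutativeRing c ℓ) where
  open CommutativeRing R
    using (Carrier; _+_; _*_; 0#; 1#; _≈_; setoid; +-commutativeSemigroup; +-cong;
           +-identityˡ; +-identityʳ; *-identityˡ; *-identityʳ; *-assoc; *-cong; zeroˡ; distribʳ)
    renaming (refl to ≈-refl; sym to ≈-sym; trans to ≈-trans; reflexive to ≈-reflexive)
  open WithRing R
  open import Algebra.Properties.CommutativeSemigroup +-commutativeSemigroup using (interchange)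
  open import Relation.Binary.Reasoning.Setoid setoid

  ⟦_⟧_ : Bool → Carrier → Carrier
  ⟦ b ⟧ a = if b then a else 0#

  ⟦⟧-0 : ∀ b → ⟦ b ⟧ 0# ≈ 0#
  ⟦⟧-0 true  = ≈-refl
  ⟦⟧-0 false = ≈-refl

  ⟦⟧-∧ : ∀ b c a → ⟦ b ∧ c ⟧ a ≈ ⟦ c ⟧ (⟦ b ⟧ a)
  ⟦⟧-∧ true  c a = ≈-refl
  ⟦⟧-∧ false c a = ≈-sym (⟦⟧-0 c)

  x*a≈y⇒x≈y*b : ∀ {x y a b} → a * b ≈ 1# → x * a ≈ y → x ≈ y * b
  x*a≈y⇒x≈y*b {x} {y} {a} {b} ab≈1 xa≈y = begin
    x            ≈⟨ ≈-sym (*-identityʳ x) ⟩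
    x * 1#       ≈⟨ *-cong ≈-refl (≈-sym ab≈1) ⟩
    x * (a * b)  ≈⟨ ≈-sym (*-assoc x a b) ⟩
    (x * a) * b  ≈⟨ *-cong xa≈y ≈-refl ⟩
    y * b        ∎

  sumSubsets-cong : ∀ n {F G : (Fin n → Bool) → Carrier} → (∀ X → F X ≈ G X) → sumSubsets n F ≈ sumSubsets n G
  sumSubsets-cong zero    F≈G = F≈G _
  sumSubsets-cong (suc n) F≈G = +-cong (sumSubsets-cong n (λ X → F≈G _)) (sumSubsets-cong n (λ X → F≈G _))

  sumSubsets-zero : ∀ n {F : (Fin n → Bool) → Carrier} → (∀ X → F X ≈ 0#) → sumSubsets n F ≈ 0#
  sumSubsets-zero zero    F≈0 = F≈0 _
  sumSubsets-zero (suc n) F≈0 =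
    ≈-trans (+-cong (sumSubsets-zero n (λ X → F≈0 _)) (sumSubsets-zero n (λ X → F≈0 _))) (+-identityˡ 0#)

  sumSubsets-+ : ∀ n (F G : (Fin n → Bool) → Carrier) →
                 sumSubsets n (λ X → F X + G X) ≈ sumSubsets n F + sumSubsets n G
  sumSubsets-+ zero    F G = ≈-refl
  sumSubsets-+ (suc n) F G = ≈-trans (+-cong (sumSubsets-+ n _ _) (sumSubsets-+ n _ _)) (interchange _ _ _ _)

  sumSubsets-*ʳ : ∀ n (F : (Fin n → Bool) → Carrier) a → sumSubsets n F * a ≈ sumSubsets n (λ X → F X * a)
  sumSubsets-*ʳ zero    F a = ≈-refl
  sumSubsets-*ʳ (suc n) F a = ≈-trans (distribʳ a _ _) (+-cong (sumSubsets-*ʳ n _ a) (sumSubsets-*ʳ n _ a))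

  sumSubsets-swap : ∀ n m (F : (Fin n → Bool) → (Fin m → Bool) → Carrier) →
                    sumSubsets n (λ X → sumSubsets m (F X)) ≈ sumSubsets m (λ Y → sumSubsets n (λ X → F X Y))
  sumSubsets-swap zero    m F = ≈-refl
  sumSubsets-swap (suc n) m F = ≈-trans (+-cong (sumSubsets-swap n m _) (sumSubsets-swap n m _)) (≈-sym (sumSubsets-+ m _ _))

  sumFin-cong : ∀ {n} {f g : Fin n → Carrier} → (∀ x → f x ≈ g x) → sumFin f ≈ sumFin g
  sumFin-cong {zero}  f≈g = ≈-refl
  sumFin-cong {suc n} f≈g = +-cong (f≈g zero) (sumFin-cong (λ x → f≈g (suc x)))

  sumFin-+ : ∀ {n} (f g : Fin n → Carrier) → sumFin (λ x → f x + g x) ≈ sumFin f + sumFin g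
  sumFin-+ {zero}  f g = ≈-sym (+-identityˡ 0#)
  sumFin-+ {suc n} f g = ≈-trans (+-cong ≈-refl (sumFin-+ (λ x → f (suc x)) (λ x → g (suc x)))) (interchange _ _ _ _)

  sumSubsets-sumFin-swap : ∀ n {m} (F : (Fin n → Bool) → Fin m → Carrier) →
                           sumSubsets n (λ X → sumFin (F X)) ≈ sumFin (λ y → sumSubsets n (λ X → F X y))
  sumSubsets-sumFin-swap zero    F = ≈-refl
  sumSubsets-sumFin-swap (suc n) {m} F =
    ≈-trans (+-cong (sumSubsets-sumFin-swap n {m} _) (sumSubsets-sumFin-swap n {m} _)) (≈-sym (sumFin-+ {m} _ _))

  natR-countFin : ∀ {n} (f : Fin n → Bool) a → natR (countFin f) * a ≈ sumFin (λ x → ⟦ f x ⟧ a)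
  natR-countFin {zero}  f a = zeroˡ a
  natR-countFin {suc n} f a with f zero
  ... | true  = ≈-trans (distribʳ a 1# _) (+-cong (*-identityˡ a) (natR-countFin (λ x → f (suc x)) a))
  ... | false = ≈-trans (natR-countFin (λ x → f (suc x)) a) (≈-sym (+-identityˡ _))

  sumSubsets-≐ : ∀ n (Z : Fin n → Bool) a → sumSubsets n (λ Y → ⟦ Y ≐ Z ⟧ a) ≈ a
  sumSubsets-≐ zero    Z a = ≈-refl
  sumSubsets-≐ (suc n) Z a with Z zero
  ... | true  = ≈-trans (+-cong (sumSubsets-zero n (λ _ → ≈-refl)) (sumSubsets-≐ n (λ x → Z (suc x)) a)) (+-identityˡ a)
  ... | false = ≈-trans (+-cong (sumSubsets-≐ n (λ x → Z (suc x)) a) (sumSubsets-zero n (λ _ → ≈-refl))) (+-identityʳ a)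

  -- The hypothesis says that f maps {X ∣ A X} bijectively onto {Y ∣ B Y}, with inverse g.
  sumSubsets-reindex : ∀ n (A B : (Fin n → Bool) → Bool) (f g : (Fin n → Bool) → (Fin n → Bool)) →
                       (∀ X Y → A X ∧ (Y ≐ f X) ≡ B Y ∧ (X ≐ g Y)) →
                       ∀ a → sumSubsets n (λ X → ⟦ A X ⟧ a) ≈ sumSubsets n (λ Y → ⟦ B Y ⟧ a)
  sumSubsets-reindex n A B f g graph a = begin
    sumSubsets n (λ X → ⟦ A X ⟧ a)                                  ≈⟨ sumSubsets-cong n (λ X → ≈-sym (pick (A X) (f X))) ⟩
    sumSubsets n (λ X → sumSubsets n (λ Y → ⟦ A X ∧ (Y ≐ f X) ⟧ a)) ≈⟨ sumSubsets-cong n (λ X → sumSubsets-cong n (λ Y →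
                                                                         ≈-reflexive (cong (⟦_⟧ a) (graph X Y)))) ⟩
    sumSubsets n (λ X → sumSubsets n (λ Y → ⟦ B Y ∧ (X ≐ g Y) ⟧ a)) ≈⟨ sumSubsets-swap n n _ ⟩
    sumSubsets n (λ Y → sumSubsets n (λ X → ⟦ B Y ∧ (X ≐ g Y) ⟧ a)) ≈⟨ sumSubsets-cong n (λ Y → pick (B Y) (g Y)) ⟩
    sumSubsets n (λ Y → ⟦ B Y ⟧ a)                                  ∎
    where
    pick : ∀ b Z → sumSubsets n (λ Y → ⟦ b ∧ (Y ≐ Z) ⟧ a) ≈ ⟦ b ⟧ a
    pick b Z = ≈-trans (sumSubsets-cong n (λ Y → ⟦⟧-∧ b (Y ≐ Z) a)) (sumSubsets-≐ n Z (⟦ b ⟧ a))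

module RootCounting {c ℓ : Level} (R : CommutativeRing c ℓ) {n : ℕ} {C : BoolRel n} (C-equiv : IsBoolEquivalence C) where
  open CommutativeRing R
    using (Carrier; _+_; _*_; 0#; 1#; _≈_; setoid; +-identityʳ; *-identityˡ; *-cong; *-comm; zeroʳ)
    renaming (refl to ≈-refl; sym to ≈-sym; trans to ≈-trans; reflexive to ≈-reflexive)
  open IsEquivalence C-equiv using () renaming (sym to C-sym)
  open WithRing R
  open RingSums R
  open RootSelections C-equiv
  open import Relation.Binary.Reasoning.Setoid setoid

  rootedSum : Fin n → Carrier → Carrier
  rootedSum i a = sumSubsets n (λ Rt → ⟦ oneRootPerClass Rt ∧ Rt i ⟧ a)

  rootedSum-invariant : ∀ {x z} → C x z ≡ true → ∀ a → rootedSum x a ≈ rootedSum z a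
  rootedSum-invariant {x} {z} xz = sumSubsets-reindex n _ _ (moveRoot z) (moveRoot x) (moveRoot-graph xz)

  rootedSum*classSize : ∀ i a → rootedSum i a * natR (countFin (C i)) ≈ sumSubsets n (λ Rt → ⟦ oneRootPerClass Rt ⟧ a)
  rootedSum*classSize i a = ≈-sym (begin
    sumSubsets n (λ Rt → ⟦ oneRootPerClass Rt ⟧ a)
      ≈⟨ sumSubsets-cong n count-root ⟩
    sumSubsets n (λ Rt → natR (countFin (rootsOf Rt i)) * ⟦ oneRootPerClass Rt ⟧ a)
      ≈⟨ sumSubsets-cong n (λ Rt → natR-countFin (rootsOf Rt i) _) ⟩
    sumSubsets n (λ Rt → sumFin (λ x → ⟦ Rt x ∧ C x i ⟧ (⟦ oneRootPerClass Rt ⟧ a)))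
      ≈⟨ sumSubsets-sumFin-swap n {n} _ ⟩
    sumFin (λ x → sumSubsets n (λ Rt → ⟦ Rt x ∧ C x i ⟧ (⟦ oneRootPerClass Rt ⟧ a)))
      ≈⟨ sumFin-cong root-at ⟩
    sumFin (λ x → ⟦ C x i ⟧ rootedSum i a)
      ≈⟨ ≈-sym (natR-countFin (λ x → C x i) _) ⟩
    natR (countFin (λ x → C x i)) * rootedSum i a
      ≈⟨ *-cong (≈-reflexive (cong natR (countFin-cong {n} λ x → bool-ext C-sym C-sym))) ≈-refl ⟩
    natR (countFin (C i)) * rootedSum i a
      ≈⟨ *-comm _ _ ⟩
    rootedSum i a * natR (countFin (C i)) ∎)
    where
    count-root : ∀ Rt → ⟦ oneRootPerClass Rt ⟧ a ≈ natR (countFin (rootsOf Rt i)) * ⟦ oneRootPerClass Rt ⟧ a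
    count-root Rt with oneRootPerClass Rt in valid
    ... | true  = ≈-sym (≈-trans (*-cong (≈-reflexive (cong natR (oneRootPerClass-elim valid i))) ≈-refl)
                                 (≈-trans (*-cong (+-identityʳ 1#) ≈-refl) (*-identityˡ a)))
    ... | false = ≈-sym (zeroʳ _)

    root-at : ∀ x → sumSubsets n (λ Rt → ⟦ Rt x ∧ C x i ⟧ (⟦ oneRootPerClass Rt ⟧ a)) ≈ ⟦ C x i ⟧ rootedSum i a
    root-at x with C x i in xi
    ... | true  = ≈-trans (sumSubsets-cong n λ Rt → ≈-trans (≈-reflexive (cong (⟦_⟧ _) (∧-identityʳ (Rt x))))
                                                             (≈-sym (⟦⟧-∧ (oneRootPerClass Rt) (Rt x) a)))
                          (rootedSum-invariant xi a)
    ... | false = sumSubsets-zero n λ Rt → ≈-reflexive (cong (⟦_⟧ _) (∧-zeroʳ (Rt x)))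

module ForestWeights {c ℓ : Level} (R : CommutativeRing c ℓ) {n m : ℕ} (ends : Ends n m) where
  open CommutativeRing R
    using (Carrier; _*_; 0#; _≈_; setoid; *-cong; zeroˡ)
    renaming (refl to ≈-refl; sym to ≈-sym; trans to ≈-trans; reflexive to ≈-reflexive)
  open WithRing R
  open RingSums R
  open Connectivity ends
  open Forests ends
  open import Relation.Binary.Reasoning.Setoid setoid

  spanningSize : ℕ
  spanningSize = n ∸ numComp ends

  compSize-pos : ∀ i → 0 ℕ.< compSize ends i
  compSize-pos i = countFin-pos (conn ends full i) i (IsEquivalence.refl (conn-isEquivalence full))

  module _ (w : Fin m → Carrier) {i j : Fin n} where

    epsFij-disconnected : conn ends full i j ≡ false → epsFij ends w spanningSize i j ≈ 0#
    epsFij-disconnected ¬ij = sumSubsets-zero m λ S → sumSubsets-zero n λ Rt →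
      ≈-reflexive (cong (⟦_⟧ weight w S) (not-connected S Rt))
      where
      not-connected : ∀ S Rt → isRootedForestIJ ends spanningSize i j S Rt ≡ false
      not-connected S Rt rewrite conn-antitone {S} (λ _ → refl) ¬ij | ∧-zeroʳ (Rt i) = ∧-zeroʳ _

    module _ (ij : conn ends full i j ≡ true) (S : EdgeSet m) where
      open RootSelections (conn-isEquivalence S)
      open RootCounting R (conn-isEquivalence S)

      no-forests : ∀ {a} → sumSubsets n (λ _ → 0#) * a ≈ sumSubsets n (λ _ → 0#)
      no-forests = ≈-trans (*-cong (sumSubsets-zero n λ _ → ≈-refl) ≈-refl)
                           (≈-trans (zeroˡ _) (≈-sym (sumSubsets-zero n λ _ → ≈-refl)))

      -- Stated with isRootedForestIJ unfolded so that `with` can abstract the forest tests.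
      rootedForests*compSize :
        sumSubsets n (λ Rt → ⟦ (acyclic ends S ∧ (countFin S ≡ᵇ spanningSize) ∧ oneRootPerClass Rt) ∧ Rt i ∧ conn ends S i j ⟧ weight w S)
          * natR (compSize ends i)
        ≈ sumSubsets n (λ Rt → ⟦ acyclic ends S ∧ (countFin S ≡ᵇ spanningSize) ∧ oneRootPerClass Rt ⟧ weight w S)
      rootedForests*compSize with acyclic ends S in acyc | countFin S ≡ᵇ spanningSize in size
      ... | false | _     = no-forests
      ... | true  | false = no-forests
      ... | true  | true  = begin
        sumSubsets n (λ Rt → ⟦ oneRootPerClass Rt ∧ Rt i ∧ conn ends S i j ⟧ weight w S) * natR (compSize ends i)
          ≈⟨ *-cong (sumSubsets-cong n λ Rt → ≈-reflexive (cong (λ b → ⟦ oneRootPerClass Rt ∧ b ⟧ weight w S)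
                                                                 (trans (cong (Rt i ∧_) (spans ij)) (∧-identityʳ (Rt i)))))
                    (≈-reflexive (cong natR same-component)) ⟩
        rootedSum i (weight w S) * natR (countFin (conn ends S i))
          ≈⟨ rootedSum*classSize i (weight w S) ⟩
        sumSubsets n (λ Rt → ⟦ oneRootPerClass Rt ⟧ weight w S) ∎
        where
        spans : conn ends full ⊆ᵣ conn ends S
        spans = forest-spanning acyc (≡ᵇ⇒≡ size)

        same-component : compSize ends i ≡ countFin (conn ends S i)
        same-component = countFin-cong {n} λ x → bool-ext (spans {i} {x}) (conn-mono (λ _ → refl))

    epsFij*compSize : conn ends full i j ≡ true → epsFij ends w spanningSize i j * natR (compSize ends i) ≈ epsF ends w spanningSize
    epsFij*compSize ij = ≈-trans (sumSubsets-*ʳ m _ _) (sumSubsets-cong m (rootedForests*compSize ij))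

open CommutativeRing using (Carrier; _*_; _≈_; 1#)

lemma1 : {c ℓ : Level} (R : CommutativeRing c ℓ) →
    let open WithRing R
    in (inv : Carrier R → Carrier R) →
       (∀ k → _≈_ R (_*_ R (natR (suc k)) (inv (natR (suc k)))) (1# R)) →
       (n m : ℕ) (ends : Ends n m) (w : Fin m → Carrier R) →
       (i j : Fin n) →
       _≈_ R (epsFij ends w (n ∸ numComp ends) i j)
             (_*_ R (epsF ends w (n ∸ numComp ends)) (Jbar ends inv i j))
lemma1 R inv natR-invertible n m ends w i j = by-connectivity (conn ends full i j) refl
  where
  open CommutativeRing R using (0#; setoid; zeroʳ) renaming (sym to ≈-sym)
  open WithRing R
  open RingSums R using (x*a≈y⇒x≈y*b)
  open ForestWeights R ends
  open import Relation.Binary.Reasoning.Setoid setoid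

  N : Carrier R
  N = natR (compSize ends i)

  N-invertible : _≈_ R (_*_ R N (inv N)) (1# R)
  N-invertible = invertible (compSize-pos i)
    where
    invertible : ∀ {x} → 0 ℕ.< x → _≈_ R (_*_ R (natR x) (inv (natR x))) (1# R)
    invertible {suc x} _ = natR-invertible x

  by-connectivity : ∀ b → conn ends full i j ≡ b →
                    _≈_ R (epsFij ends w spanningSize i j) (_*_ R (epsF ends w spanningSize) (Jbar ends inv i j))
  by-connectivity true ij = begin
    epsFij ends w spanningSize i j            ≈⟨ x*a≈y⇒x≈y*b N-invertible (epsFij*compSize w ij) ⟩
    _*_ R (epsF ends w spanningSize) (inv N)  ≡⟨ cong (λ b → _*_ R (epsF ends w spanningSize) (if b then inv N else 0#)) (sym ij) ⟩
    _*_ R (epsF ends w spanningSize) (Jbar ends inv i j) ∎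
  by-connectivity false ij = begin
    epsFij ends w spanningSize i j            ≈⟨ epsFij-disconnected w ij ⟩
    0#                                        ≈⟨ ≈-sym (zeroʳ _) ⟩
    _*_ R (epsF ends w spanningSize) 0#       ≡⟨ cong (λ b → _*_ R (epsF ends w spanningSize) (if b then inv N else 0#)) (sym ij) ⟩
    _*_ R (epsF ends w spanningSize) (Jbar ends inv i j) ∎
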